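{- Let $P$ be a normal logic program with exactly $n$ clauses, $2\le n\le 4$, having $s(n)$ stable models. Then there are pairwise distinct atoms $a,b,c,d$ such that: if $n=2$, $\overline{P}=CP[\{a,b\}]$; if $n=3$, $\overline{P}=CP[\{a,b,c\}]$; if $n=4$, $\overline{P}=CP[\{a,b,c,d\}]$ or $\overline{P}=CP[\{a,b\}]\cup CP[\{c,d\}]$.
   Context: A (normal) logic program is a finite set of clauses $a\leftarrow b_1,\ldots,b_m,\mathbf{not}(c_1),\ldots,\mathbf{not}(c_k)$ with atoms $a,b_i,c_j$ (bodies regarded as sets of literals). For a set of atoms $M$, the reduct $P^M$ is obtained by deleting every clause whose body contains $\mathbf{not}(c)$ with $c\in M$ and deleting all negative literals from the remaining clauses; $M$ is a stable model of $P$ if $M$ is the least model of $P^M$. $s(n)$ is the maximum number of stable models of a logic program with at most $n$ clauses. An atom occurring in $P$ is redundant if it is not the head of any clause of $P$; $\overline{P}$ is obtained from $P$ by removing all negated occurrences $\mathbf{not}(q)$ of redundant atoms $q$. For $A=\{a_1,\ldots,a_k\}$, $CP[A]$ consists of the clauses $a_i\leftarrow\mathbf{not}(a_1),\ldots,\mathbf{not}(a_{i-1}),\mathbf{not}(a_{i+1}),\ldots,\mathbf{not}(a_k)$, $i=1,\ldots,k$. -}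

module Defs where

open import Level using (0ℓ)
open import Data.Nat using (ℕ; _≤_; _≟_)
open import Data.List using (List; []; _∷_; map; filter; length)
open import Data.List.Membership.Propositional using (_∈_)
open import Data.List.Membership.DecPropositional _≟_ using (_∈?_)
open import Data.List.Relation.Unary.All using (All)
open import Data.List.Relation.Unary.AllPairs using (AllPairs)
open import Data.Product using (Σ; _×_; ∃; _,_)
open import Relation.Nullary using (¬_)
open import Relation.Binary.PropositionalEquality using (_≡_)
open import Function.Bundles using (_⇔_)

Atom : Set
Atom = ℕ

-- A clause  head ← pos₁,…,posₘ, not(neg₁),…,not(negₖ).
-- The body lists are regarded as sets (see _≈C_ below).
record Clause : Set where
  constructor _⇐_∣_
  field
    head : Atom
    pos  : List Atom
    neg  : List Atom
open Clause public

-- A program is a finite set of clauses, represented by a list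
-- (regarded as a set, see _≈P_ below).
Program : Set
Program = List Clause

_≈S_ : List Atom → List Atom → Set
A ≈S B = ∀ x → (x ∈ A) ⇔ (x ∈ B)

_≈C_ : Clause → Clause → Set
C ≈C D = (head C ≡ head D) × (pos C ≈S pos D) × (neg C ≈S neg D)

_≈P_ : Program → Program → Set
P ≈P Q = All (λ C → ∃ λ D → D ∈ Q × C ≈C D) P
       × All (λ D → ∃ λ C → C ∈ P × C ≈C D) Q

HasExactlyClauses : ℕ → Program → Set
HasExactlyClauses n P = length P ≡ n × AllPairs (λ C D → ¬ (C ≈C D)) P

-- P has at most n clauses (a list of length ≤ n; repetitions only
-- decrease the number of clauses of the represented set).
HasAtMostClauses : ℕ → Program → Set
HasAtMostClauses n P = length P ≤ n

AtomSet : Set₁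
AtomSet = Atom → Set

reduct : Program → List Atom → Program
reduct [] M = []
reduct (C ∷ P) M with Data.List.Relation.Unary.Any.any? (λ c → c ∈? M) (neg C)
  where import Data.List.Relation.Unary.Any
... | Relation.Nullary.yes _ = reduct P M
  where import Relation.Nullary
... | Relation.Nullary.no _ = (head C ⇐ pos C ∣ []) ∷ reduct P M
  where import Relation.Nullary

IsModel : Program → AtomSet → Set
IsModel Q X = All (λ C → All X (pos C) → X (head C)) Q

IsLeastModel : Program → List Atom → Set₁
IsLeastModel Q M = IsModel Q (_∈ M) × (∀ (X : AtomSet) → IsModel Q X → ∀ a → a ∈ M → X a)

IsStable : Program → List Atom → Set₁
IsStable P M = IsLeastModel (reduct P M) M

HasStableCount : Program → ℕ → Set₁
HasStableCount P k =
  Σ (List (List Atom)) λ Ms →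
    length Ms ≡ k
    × All (IsStable P) Ms
    × AllPairs (λ M N → ¬ (M ≈S N)) Ms
    × (∀ M → IsStable P M → ∃ λ N → N ∈ Ms × M ≈S N)

IsS : ℕ → ℕ → Set₁
IsS n k = (Σ Program λ Q → HasAtMostClauses n Q × HasStableCount Q k)
        × (∀ Q j → HasAtMostClauses n Q → HasStableCount Q j → j ≤ k)

heads : Program → List Atom
heads P = map head P

bar : Program → Program
bar P = map (λ C → head C ⇐ pos C ∣ filter (λ q → q ∈? heads P) (neg C)) P

CP : List Atom → Program
CP A = map (λ a → a ⇐ [] ∣ filter (λ b → Relation.Nullary.¬? (a ≟ b)) A) A
  where import Relation.Nullary

module Submission where

{-
Stable models of a program are pairwise ⊆-incomparable sets of clause heads, and
CP[0..n-1] has n stable models, so s(n) ≥ n and a program P with n clauses and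
s(n) stable models has n distinct ones. Record each of them by its trace: the set
of indices i such that the head of clause i belongs to the model. Supportedness,
closure under applicable clauses and groundedness of stable models constrain the
clauses through the traces alone: an atom of the positive body of clause i lies in
every model containing its head, no atom of its negative body shares a model with
its head, and a clause whose body holds in a model has its head in that model.
For n ≤ 4 an exhaustive check over all n-element antichains of subsets of Fin n
shows that these constraints force distinct heads, empty positive bodies, and the
head of clause j in the negative body of clause i exactly when i ≠ j lie in a
common block of one of the partitions {Fin n} or {{a,b},{c,d}}; after removing
the redundant negations this says that P̄ is CP[A] or CP[A₁] ∪ CP[A₂].
-}

open import Defs
open import Level using (0ℓ)
open import Data.Nat using (ℕ; zero; suc; _≤_; z≤n; s≤s; _≟_)
open import Data.Nat.Properties using (≤-reflexive; m≤n⇒m⊓n≡m; <⇒≢)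
open import Data.Empty using (⊥-elim)
open import Data.Fin using (Fin; #_) renaming (_≟_ to _≟ᶠ_)
open import Data.Fin.Properties using () renaming (all? to allFin?; any? to anyFin?)
open import Data.Fin.Subset using (Subset) renaming (_∈_ to _∈ˢ_; _∉_ to _∉ˢ_; _⊆_ to _⊆ˢ_)
open import Data.Fin.Subset.Properties using (anySubset?) renaming (_∈?_ to _∈ˢ?_; _⊆?_ to _⊆ˢ?_)
open import Data.List
  using (List; []; _∷_; [_]; _++_; _∷ʳ_; map; concatMap; filter; length; lookup; take; upTo)
open import Data.List.Extrema.Nat using (max; xs≤max)
open import Data.List.Properties using (length-map; length-upTo; length-take; ++-identityʳ; ∷ʳ-++)
open import Data.List.Membership.Propositional using (_∈_; _∉_; find; lose)
open import Data.List.Membership.Propositional.Properties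
  using (∈-map⁺; ∈-map⁻; ∈-filter⁺; ∈-filter⁻; ∈-lookup; ∈-concatMap⁺; ∈-concatMap⁻)
open import Data.List.Membership.DecPropositional _≟_ using (_∈?_)
open import Data.List.Relation.Binary.Subset.Propositional using (_⊆_)
open import Data.List.Relation.Unary.All as All using (All; []; _∷_)
import Data.List.Relation.Unary.All.Properties as All
open import Data.List.Relation.Unary.AllPairs as AllPairs using (AllPairs; []; _∷_)
import Data.List.Relation.Unary.AllPairs.Properties as AllPairs
open import Data.List.Relation.Unary.Any as Any using (Any; here; there; any?)
open import Data.List.Relation.Unary.Any.Properties using (singleton⁻; lookup-index)
open import Data.List.Relation.Unary.Unique.Propositional using (Unique)
open import Data.List.Relation.Unary.Unique.Propositional.Properties using (upTo⁺)
open import Data.Product using (_×_; ∃; _,_; proj₁; proj₂)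
open import Data.Sum using (_⊎_; inj₁; inj₂)
open import Data.Vec using (tabulate)
open import Data.Vec.Properties using (lookup∘tabulate; []=⇒lookup; lookup⇒[]=)
open import Function using (_∘_)
open import Function.Bundles using (_⇔_; mk⇔; Equivalence)
open import Function.Definitions using (Injective)
open import Function.Properties.Equivalence using () renaming (trans to ⇔-trans)
open import Relation.Binary using (Rel) renaming (Decidable to Decidable₂)
open import Relation.Binary.PropositionalEquality using (_≡_; _≢_; refl; sym; trans; cong; subst)
open import Relation.Nullary using (¬_; Dec; yes; no; ¬?; contradiction)
open import Relation.Nullary.Decidable
  using (does; dec-true; dec-false; from-yes; toWitness; map′; decidable-stable; _×-dec_; _⊎-dec_; _→-dec_)
open import Relation.Unary using (Pred; Decidable)

Applicable : List Atom → Clause → Set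
Applicable M C = ¬ Any (_∈ M) (neg C)

ClosedUnder : Program → List Atom → AtomSet → Set
ClosedUnder P M X = ∀ {C} → C ∈ P → Applicable M C → All X (pos C) → X (head C)

Supported : Program → List Atom → Atom → Set
Supported P M a = ∃ λ C → C ∈ P × head C ≡ a × Applicable M C × All (_∈ M) (pos C)

model-reduct⇒closed : ∀ P M {X} → IsModel (reduct P M) X → ClosedUnder P M X
model-reduct⇒closed (C ∷ P) M model (here refl) app body with any? (_∈? M) (neg C)
... | yes blocked = contradiction blocked app
... | no _ = All.head model body
model-reduct⇒closed (C ∷ P) M model (there C∈P) app body with any? (_∈? M) (neg C)
... | yes _ = model-reduct⇒closed P M model C∈P app body
... | no _ = model-reduct⇒closed P M (All.tail model) C∈P app body

closed⇒model-reduct : ∀ P M {X} → ClosedUnder P M X → IsModel (reduct P M) X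
closed⇒model-reduct [] M closed = []
closed⇒model-reduct (C ∷ P) M closed with any? (_∈? M) (neg C)
... | yes _ = closed⇒model-reduct P M (closed ∘ there)
... | no app = closed (here refl) app ∷ closed⇒model-reduct P M (closed ∘ there)

module _ {P M} (stable : IsStable P M) where

  stable-closed : ClosedUnder P M (_∈ M)
  stable-closed = model-reduct⇒closed P M (proj₁ stable)

  stable-least : ∀ X → ClosedUnder P M X → ∀ {a} → a ∈ M → X a
  stable-least X closed = proj₂ stable X (closed⇒model-reduct P M closed) _

  stable-supported : ∀ {a} → a ∈ M → Supported P M a
  stable-supported = proj₂ ∘ stable-least (λ a → a ∈ M × Supported P M a) closed
    where
    closed : ClosedUnder P M (λ a → a ∈ M × Supported P M a)
    closed C∈P app body = stable-closed C∈P app body′ , _ , C∈P , refl , app , body′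
      where body′ = All.map proj₁ body

  stable-grounded : ∀ {x} → (∀ {C} → C ∈ P → head C ≡ x → x ∈ pos C) → x ∉ M
  stable-grounded {x} self x∈M = proj₂ (stable-least (λ a → a ∈ M × a ≢ x) closed x∈M) refl
    where
    closed : ClosedUnder P M (λ a → a ∈ M × a ≢ x)
    closed C∈P app body = stable-closed C∈P app (All.map proj₁ body)
                        , λ head≡x → proj₂ (All.lookup body (self C∈P head≡x)) refl

stable-minimal : ∀ {P M N} → IsStable P M → IsStable P N → M ⊆ N → N ⊆ M
stable-minimal {P} {M} {N} sM sN M⊆N =
  stable-least {P} {N} sN (_∈ M) λ C∈P app body → stable-closed {P} {M} sM C∈P (app ∘ Any.map M⊆N) body

cp-clause : List Atom → Atom → Clause
cp-clause L a = a ⇐ [] ∣ filter (λ b → ¬? (a ≟ b)) L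

module _ {L : List Atom} where

  ∈-CP⁻ : ∀ {C} → C ∈ CP L → ∃ λ x → x ∈ L × C ≡ cp-clause L x
  ∈-CP⁻ = ∈-map⁻ (cp-clause L)

  ∈-cp-neg⁺ : ∀ {x y} → y ∈ L → x ≢ y → y ∈ neg (cp-clause L x)
  ∈-cp-neg⁺ {x} = ∈-filter⁺ (λ b → ¬? (x ≟ b))

  cp-singleton-stable : ∀ {x} → x ∈ L → IsStable (CP L) [ x ]
  cp-singleton-stable {x} x∈L = closed⇒model-reduct (CP L) [ x ] closed , least
    where
    closed : ClosedUnder (CP L) [ x ] (_∈ [ x ])
    closed C∈CP app _ with ∈-CP⁻ C∈CP
    ... | y , _ , refl with y ≟ x
    ... | yes y≡x = here y≡x
    ... | no y≢x = contradiction (Any.map (λ { refl → here refl }) (∈-cp-neg⁺ x∈L y≢x)) app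
    app : Applicable [ x ] (cp-clause L x)
    app blocked with find blocked
    ... | b , b∈neg , here b≡x = proj₂ (∈-filter⁻ (λ b → ¬? (x ≟ b)) {xs = L} b∈neg) (sym b≡x)
    least : ∀ X → IsModel (reduct (CP L) [ x ]) X → ∀ a → a ∈ [ x ] → X a
    least X model a (here refl) =
      model-reduct⇒closed (CP L) [ x ] model (∈-map⁺ (cp-clause L) x∈L) app []

  module _ {M} (stable : IsStable (CP L) M) where

    cp-stable⊆ : M ⊆ L
    cp-stable⊆ a∈M with stable-supported stable a∈M
    ... | C , C∈CP , refl , _ with ∈-CP⁻ C∈CP
    ... | x , x∈L , refl = x∈L

    cp-stable-unique : ∀ {a b} → a ∈ M → b ∈ M → a ≡ b
    cp-stable-unique a∈M b∈M with stable-supported stable a∈M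
    ... | C , C∈CP , refl , app , _ with ∈-CP⁻ C∈CP
    ... | x , _ , refl with x ≟ _
    ... | yes x≡b = x≡b
    ... | no x≢b = contradiction (Any.map (λ { refl → b∈M }) (∈-cp-neg⁺ (cp-stable⊆ b∈M) x≢b)) app

cp-stable-inhabited : ∀ {x L M} → IsStable (CP (x ∷ L)) M → ∃ (_∈ M)
cp-stable-inhabited {x} {L} {M} stable = inhabited (any? (_∈? M) (neg (cp-clause (x ∷ L) x)))
  where
  inhabited : Dec (Any (_∈ M) (neg (cp-clause (x ∷ L) x))) → ∃ (_∈ M)
  inhabited (yes blocked) = let a , _ , a∈M = find blocked in a , a∈M
  inhabited (no app) = x , stable-closed {CP (x ∷ L)} stable (here refl) app []

cp-stableCount : ∀ {x L} → Unique (x ∷ L) → HasStableCount (CP (x ∷ L)) (length (x ∷ L))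
cp-stableCount {x} {L} unique = map [_] K , length-map [_] K , stables , distinct , complete
  where
  K = x ∷ L
  stables : All (IsStable (CP K)) (map [_] K)
  stables = All.map⁺ (All.tabulate cp-singleton-stable)
  distinct : AllPairs (λ M N → ¬ (M ≈S N)) (map [_] K)
  distinct = AllPairs.map⁺ (AllPairs.map singletons-distinct unique)
    where
    singletons-distinct : ∀ {a b} → a ≢ b → ¬ ([ a ] ≈S [ b ])
    singletons-distinct a≢b a≈b = a≢b (singleton⁻ (Equivalence.to (a≈b _) (here refl)))
  complete : ∀ M → IsStable (CP K) M → ∃ λ N → N ∈ map [_] K × M ≈S N
  complete M stable with cp-stable-inhabited {x} {L} {M} stable
  ... | a , a∈M = [ a ] , ∈-map⁺ [_] (cp-stable⊆ {K} {M} stable a∈M)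
                , λ b → mk⇔ (λ b∈M → here (cp-stable-unique {K} {M} stable b∈M a∈M))
                            λ { (here refl) → a∈M }

IsS⇒n≤k : ∀ {n k} → IsS n k → n ≤ k
IsS⇒n≤k {zero} _ = z≤n
IsS⇒n≤k {suc n} {k} (_ , maximal) =
  subst (_≤ k) (length-upTo (suc n)) (maximal (CP (upTo (suc n))) _ size (cp-stableCount (upTo⁺ (suc n))))
  where
  size : HasAtMostClauses (suc n) (CP (upTo (suc n)))
  size = ≤-reflexive (trans (length-map _ (upTo (suc n))) (length-upTo (suc n)))

_⇔-dec_ : ∀ {A B : Set} → Dec A → Dec B → Dec (A ⇔ B)
a? ⇔-dec b? = map′ (λ (to , from) → mk⇔ to from) (λ e → Equivalence.to e , Equivalence.from e)
                   ((a? →-dec b?) ×-dec (b? →-dec a?))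

allSubset? : ∀ {n} {P : Pred (Subset n) 0ℓ} → Decidable P → Dec (∀ s → P s)
allSubset? P? = map′ (λ ¬∃¬ s → decidable-stable (P? s) λ ¬Ps → ¬∃¬ (s , ¬Ps))
                     (λ ∀P (s , ¬Ps) → ¬Ps (∀P s))
                     (¬? (anySubset? (¬? ∘ P?)))

Incomparable : ∀ {n} → Rel (Subset n) 0ℓ
Incomparable s t = ¬ s ⊆ˢ t × ¬ t ⊆ˢ s

incomparable? : ∀ {n} → Decidable₂ (Incomparable {n})
incomparable? s t = ¬? (s ⊆ˢ? t) ×-dec ¬? (t ⊆ˢ? s)

module CliqueSearch {A : Set} (universal? : ∀ {P : Pred A 0ℓ} → Decidable P → Dec (∀ x → P x))
                    {R : Rel A 0ℓ} (R? : Decidable₂ R) {Q : Pred (List A) 0ℓ} (Q? : Decidable Q) where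

  AllExtensions : ℕ → List A → Set
  AllExtensions zero    G = Q G
  AllExtensions (suc k) G = ∀ x → All (λ g → R g x) G → AllExtensions k (G ∷ʳ x)

  allExtensions? : ∀ k G → Dec (AllExtensions k G)
  allExtensions? zero    G = Q? G
  allExtensions? (suc k) G = universal? λ x → All.all? (λ g → R? g x) G →-dec allExtensions? k (G ∷ʳ x)

  extensions-satisfy : ∀ {G} F → AllExtensions (length F) G → All (λ g → All (R g) F) G →
                       AllPairs R F → Q (G ++ F)
  extensions-satisfy {G} [] ext _ _ = subst Q (sym (++-identityʳ G)) ext
  extensions-satisfy {G} (x ∷ F) ext G-R (x-R ∷ F-R) =
    subst Q (∷ʳ-++ G x F)
      (extensions-satisfy F (ext x (All.map All.head G-R)) (All.∷ʳ⁺ (All.map All.tail G-R) x-R) F-R)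

  cliques-satisfy : ∀ {k} → AllExtensions k [] → ∀ F → length F ≡ k → AllPairs R F → Q F
  cliques-satisfy ext F refl = extensions-satisfy F ext []

partitions : (n : ℕ) → List (List (List (Fin n)))
partitions 2 = ((# 0 ∷ # 1 ∷ []) ∷ []) ∷ []
partitions 3 = ((# 0 ∷ # 1 ∷ # 2 ∷ []) ∷ []) ∷ []
partitions 4 = ((# 0 ∷ # 1 ∷ # 2 ∷ # 3 ∷ []) ∷ [])
             ∷ ((# 0 ∷ # 1 ∷ []) ∷ (# 2 ∷ # 3 ∷ []) ∷ [])
             ∷ ((# 0 ∷ # 2 ∷ []) ∷ (# 1 ∷ # 3 ∷ []) ∷ [])
             ∷ ((# 0 ∷ # 3 ∷ []) ∷ (# 1 ∷ # 2 ∷ []) ∷ [])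
             ∷ []
partitions _ = []

module _ {n : ℕ} where

  _∈ᶠ?_ : ∀ (i : Fin n) B → Dec (i ∈ B)
  i ∈ᶠ? B = any? (i ≟ᶠ_) B

  SameBlock : List (List (Fin n)) → Fin n → Fin n → Set
  SameBlock bs i j = Any (λ B → i ∈ B × j ∈ B) bs

  sameBlock? : ∀ bs i j → Dec (SameBlock bs i j)
  sameBlock? bs i j = any? (λ B → i ∈ᶠ? B ×-dec j ∈ᶠ? B) bs

  IsPartition : List (List (Fin n)) → Set
  IsPartition bs = (∀ i → Any (i ∈_) bs) × All (λ B → ∀ i j → i ∈ B → SameBlock bs i j → j ∈ B) bs

  isPartition? : ∀ bs → Dec (IsPartition bs)
  isPartition? bs = allFin? (λ i → any? (i ∈ᶠ?_) bs)
    ×-dec All.all? (λ B → allFin? λ i → allFin? λ j →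
                      i ∈ᶠ? B →-dec (sameBlock? bs i j →-dec j ∈ᶠ? B)) bs

partitions-are-partitions : ∀ n → All IsPartition (partitions n)
partitions-are-partitions 0 = []
partitions-are-partitions 1 = []
partitions-are-partitions 2 = from-yes (All.all? isPartition? (partitions 2))
partitions-are-partitions 3 = from-yes (All.all? isPartition? (partitions 3))
partitions-are-partitions 4 = from-yes (All.all? isPartition? (partitions 4))
partitions-are-partitions (suc (suc (suc (suc (suc _))))) = []

-- F stands for the traces of stable models of a program whose clauses are indexed by
-- Fin n: i ∈ˢ s says that the head of clause i lies in the model s. An atom of the
-- positive body of clause i is then forced by i (positive-forced), an atom of its
-- negative body never occurs together with i (negative-apart).
module Certificate {n} (F : List (Subset n)) where

  Occurs : Fin n → Set
  Occurs i = Any (i ∈ˢ_) F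

  Together : Fin n → Fin n → Set
  Together i j = Any (λ s → i ∈ˢ s × j ∈ˢ s) F

  Forces : Fin n → Fin n → Set
  Forces i j = i ≢ j × All (λ s → i ∈ˢ s → j ∈ˢ s) F

  Fires : Fin n → Subset n → Set
  Fires i v = ∀ j → (Forces i j → j ∈ˢ v) × (j ∈ˢ v → Together i j)

  -- The model v must block clause i, and the head of clause j is the only candidate.
  SoleBlocker : Fin n → Fin n → Set
  SoleBlocker i j = Any (λ v → i ∉ˢ v × ∀ l → l ∈ˢ v → Together i l ⊎ l ≡ j) F

  Separating : Set
  Separating = ∀ i j → i ≢ j → Any (λ s → i ∈ˢ s × j ∉ˢ s ⊎ j ∈ˢ s × i ∉ˢ s) F

  Contradictory : Set
  Contradictory = ∃ λ i → Occurs i × Any (λ v → i ∉ˢ v × Fires i v) F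

  Normal : Set
  Normal = ∀ i → Occurs i × (∀ j → ¬ Forces i j) × (∀ j → Together i j ⊎ SoleBlocker i j)

  Matches : List (List (Fin n)) → Set
  Matches bs = ∀ i j → (¬ Together i j) ⇔ (i ≢ j × SameBlock bs i j)

  Certified : Set
  Certified = Separating × (Contradictory ⊎ Normal × Any Matches (partitions n))

  occurs? : ∀ i → Dec (Occurs i)
  occurs? i = any? (i ∈ˢ?_) F

  together? : ∀ i j → Dec (Together i j)
  together? i j = any? (λ s → i ∈ˢ? s ×-dec j ∈ˢ? s) F

  forces? : ∀ i j → Dec (Forces i j)
  forces? i j = ¬? (i ≟ᶠ j) ×-dec All.all? (λ s → i ∈ˢ? s →-dec j ∈ˢ? s) F

  fires? : ∀ i v → Dec (Fires i v)
  fires? i v = allFin? λ j → (forces? i j →-dec j ∈ˢ? v) ×-dec (j ∈ˢ? v →-dec together? i j)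

  soleBlocker? : ∀ i j → Dec (SoleBlocker i j)
  soleBlocker? i j =
    any? (λ v → ¬? (i ∈ˢ? v) ×-dec allFin? λ l → l ∈ˢ? v →-dec (together? i l ⊎-dec l ≟ᶠ j)) F

  separating? : Dec Separating
  separating? = allFin? λ i → allFin? λ j → ¬? (i ≟ᶠ j) →-dec
    any? (λ s → (i ∈ˢ? s ×-dec ¬? (j ∈ˢ? s)) ⊎-dec (j ∈ˢ? s ×-dec ¬? (i ∈ˢ? s))) F

  contradictory? : Dec Contradictory
  contradictory? = anyFin? λ i → occurs? i ×-dec any? (λ v → ¬? (i ∈ˢ? v) ×-dec fires? i v) F

  normal? : Dec Normal
  normal? = allFin? λ i → occurs? i ×-dec allFin? (λ j → ¬? (forces? i j))
                                    ×-dec allFin? (λ j → together? i j ⊎-dec soleBlocker? i j)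

  matches? : ∀ bs → Dec (Matches bs)
  matches? bs = allFin? λ i → allFin? λ j →
    ¬? (together? i j) ⇔-dec (¬? (i ≟ᶠ j) ×-dec sameBlock? bs i j)

  certified? : Dec Certified
  certified? = separating? ×-dec (contradictory? ⊎-dec (normal? ×-dec any? matches? (partitions n)))

module AntichainSearch {n : ℕ} =
  CliqueSearch (allSubset? {n}) {R = Incomparable} incomparable?
               {Q = Certificate.Certified} Certificate.certified?

antichains-certified : ∀ n → 2 ≤ n → n ≤ 4 → ∀ (F : List (Subset n)) →
                       length F ≡ n → AllPairs Incomparable F → Certificate.Certified F
antichains-certified 1 (s≤s ()) _
antichains-certified 2 _ _ =
  AntichainSearch.cliques-satisfy (toWitness {a? = AntichainSearch.allExtensions? {2} 2 []} _)
antichains-certified 3 _ _ =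
  AntichainSearch.cliques-satisfy (toWitness {a? = AntichainSearch.allExtensions? {3} 3 []} _)
antichains-certified 4 _ _ =
  AntichainSearch.cliques-satisfy (toWitness {a? = AntichainSearch.allExtensions? {4} 4 []} _)
antichains-certified (suc (suc (suc (suc (suc _))))) _ (s≤s (s≤s (s≤s (s≤s ()))))

module Traces (P : Program) where

  clause : Fin (length P) → Clause
  clause = lookup P

  hd : Fin (length P) → Atom
  hd i = head (clause i)

  clause-index : ∀ {C} → C ∈ P → ∃ λ i → clause i ≡ C
  clause-index C∈P = Any.index C∈P , sym (lookup-index C∈P)

  heads-index : ∀ {a} → a ∈ heads P → ∃ λ i → hd i ≡ a
  heads-index a∈heads with ∈-map⁻ head a∈heads
  ... | C , C∈P , refl with clause-index C∈P
  ... | i , refl = i , refl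

  stable⊆heads : ∀ {M} → IsStable P M → M ⊆ heads P
  stable⊆heads {M} stable a∈M with stable-supported {P} {M} stable a∈M
  ... | C , C∈P , refl , _ = ∈-map⁺ head C∈P

  trace : List Atom → Subset (length P)
  trace M = tabulate λ i → does (hd i ∈? M)

  ∈-trace⁺ : ∀ {M i} → hd i ∈ M → i ∈ˢ trace M
  ∈-trace⁺ {M} {i} hd∈M =
    lookup⇒[]= i (trace M) (trans (lookup∘tabulate _ i) (dec-true (hd i ∈? M) hd∈M))

  ∈-trace⁻ : ∀ {M i} → i ∈ˢ trace M → hd i ∈ M
  ∈-trace⁻ {M} {i} i∈ = decidable-stable (hd i ∈? M) λ hd∉M → contradiction
    (trans (sym ([]=⇒lookup i∈)) (trans (lookup∘tabulate _ i) (dec-false (hd i ∈? M) hd∉M))) λ ()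

  trace-⊆⁻ : ∀ {M N} → IsStable P M → trace M ⊆ˢ trace N → M ⊆ N
  trace-⊆⁻ {M} stable M⊆N a∈M with heads-index (stable⊆heads {M} stable a∈M)
  ... | i , refl = ∈-trace⁻ (M⊆N (∈-trace⁺ a∈M))

  distinct-stable-incomparable : ∀ {M N} → IsStable P M → IsStable P N → ¬ M ≈S N →
                                 Incomparable (trace M) (trace N)
  distinct-stable-incomparable {M} {N} sM sN M≉N = M⋢N , N⋢M
    where
    M⋢N : ¬ trace M ⊆ˢ trace N
    M⋢N ⊆ = let M⊆N = trace-⊆⁻ {M} {N} sM ⊆ in M≉N λ _ → mk⇔ M⊆N (stable-minimal {P} sM sN M⊆N)
    N⋢M : ¬ trace N ⊆ˢ trace M
    N⋢M ⊆ = let N⊆M = trace-⊆⁻ {N} {M} sN ⊆ in M≉N λ _ → mk⇔ (stable-minimal {P} sN sM N⊆M) N⊆M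

  stable-traces-incomparable : ∀ {Ms} → All (IsStable P) Ms → AllPairs (λ M N → ¬ M ≈S N) Ms →
                               AllPairs Incomparable (map trace Ms)
  stable-traces-incomparable [] [] = []
  stable-traces-incomparable (sM ∷ sMs) (M≉ ∷ Ms≉) =
    All.map⁺ (All.zipWith (λ (sN , M≉N) → distinct-stable-incomparable sM sN M≉N) (sMs , M≉))
    ∷ stable-traces-incomparable sMs Ms≉

  Realised : Subset (length P) → Set₁
  Realised s = ∃ λ M → IsStable P M × s ≡ trace M

  bar-clause : Clause → Clause
  bar-clause C = head C ⇐ pos C ∣ filter (_∈? heads P) (neg C)

  Blocks : List (List (Fin (length P))) → Program
  Blocks = concatMap (CP ∘ map hd)

  module Distinct (injective : Injective _≡_ _≡_ hd) where

    clause-unique : ∀ {C i} → C ∈ P → head C ≡ hd i → C ≡ clause i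
    clause-unique C∈P head≡ with clause-index C∈P
    ... | j , refl = cong clause (injective head≡)

    module _ {M} (stable : IsStable P M) where

      stable-fires : ∀ {i} → Applicable M (clause i) → All (_∈ M) (pos (clause i)) → hd i ∈ M
      stable-fires {i} = stable-closed {P} {M} stable (∈-lookup i)

      stable-support : ∀ {i} → hd i ∈ M → Applicable M (clause i) × All (_∈ M) (pos (clause i))
      stable-support hd∈M with stable-supported {P} {M} stable hd∈M
      ... | C , C∈P , head≡ , app , body with clause-unique C∈P head≡
      ... | refl = app , body

      stable-not-self-positive : ∀ {i} → hd i ∈ pos (clause i) → hd i ∉ M
      stable-not-self-positive {i} self = stable-grounded {P} {M} stable λ C∈P head≡ →
        subst (λ C → hd i ∈ pos C) (sym (clause-unique C∈P head≡)) self

    module _ {bs} (partition : IsPartition bs) (positive : ∀ i a → a ∉ pos (clause i))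
             (negative : ∀ i j → hd j ∈ neg (clause i) ⇔ (i ≢ j × SameBlock bs i j)) where

      bar-clause≈cp : ∀ {i B} → B ∈ bs → i ∈ B → bar-clause (clause i) ≈C cp-clause (map hd B) (hd i)
      bar-clause≈cp {i} {B} B∈bs i∈B =
        refl , (λ _ → mk⇔ (⊥-elim ∘ positive i _) λ ()) , λ _ → mk⇔ to from
        where
        to : ∀ {x} → x ∈ filter (_∈? heads P) (neg (clause i)) →
                     x ∈ filter (λ b → ¬? (hd i ≟ b)) (map hd B)
        to x∈ with ∈-filter⁻ (_∈? heads P) {xs = neg (clause i)} x∈
        ... | x∈neg , x∈heads with heads-index x∈heads
        ... | j , refl with Equivalence.to (negative i j) x∈neg
        ... | i≢j , same = ∈-filter⁺ (λ b → ¬? (hd i ≟ b))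
          (∈-map⁺ hd (All.lookup (proj₂ partition) B∈bs i j i∈B same)) (i≢j ∘ injective)
        from : ∀ {x} → x ∈ filter (λ b → ¬? (hd i ≟ b)) (map hd B) →
                       x ∈ filter (_∈? heads P) (neg (clause i))
        from x∈ with ∈-filter⁻ (λ b → ¬? (hd i ≟ b)) {xs = map hd B} x∈
        ... | x∈B , hi≢x with ∈-map⁻ hd x∈B
        ... | j , j∈B , refl = ∈-filter⁺ (_∈? heads P)
          (Equivalence.from (negative i j) ((λ { refl → hi≢x refl }) , lose B∈bs (i∈B , j∈B)))
          (∈-map⁺ head (∈-lookup j))

      bar≈blocks : bar P ≈P Blocks bs
      bar≈blocks = All.tabulate left , All.tabulate right
        where
        left : ∀ {C} → C ∈ bar P → ∃ λ D → D ∈ Blocks bs × C ≈C D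
        left C∈bar with ∈-map⁻ bar-clause C∈bar
        ... | C , C∈P , refl with clause-index C∈P
        ... | i , refl with find (proj₁ partition i)
        ... | B , B∈bs , i∈B =
          cp-clause (map hd B) (hd i) ,
          ∈-concatMap⁺ (CP ∘ map hd) (lose B∈bs (∈-map⁺ (cp-clause (map hd B)) (∈-map⁺ hd i∈B))) ,
          bar-clause≈cp B∈bs i∈B
        right : ∀ {D} → D ∈ Blocks bs → ∃ λ C → C ∈ bar P × C ≈C D
        right D∈ with find (∈-concatMap⁻ (CP ∘ map hd) {xs = bs} D∈)
        ... | B , B∈bs , D∈CP with ∈-CP⁻ {L = map hd B} D∈CP
        ... | x , x∈B , refl with ∈-map⁻ hd x∈B
        ... | i , i∈B , refl =
          bar-clause (clause i) , ∈-map⁺ bar-clause (∈-lookup i) , bar-clause≈cp B∈bs i∈B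

  module Realisation {F : List (Subset (length P))} (realised : All Realised F) where
    open Certificate F

    realise-any : ∀ {Q : Pred (Subset (length P)) 0ℓ} → Any Q F → ∃ λ M → IsStable P M × Q (trace M)
    realise-any {Q} q with All.lookupAny realised q
    ... | (M , stable , s≡) , Qs = M , stable , subst Q s≡ Qs

    realise-all : ∀ {Q : Pred (Subset (length P)) 0ℓ} → (∀ {M} → IsStable P M → Q (trace M)) → All Q F
    realise-all {Q} f = All.map (λ (M , stable , s≡) → subst Q (sym s≡) (f stable)) realised

    separating⇒injective : Separating → Injective _≡_ _≡_ hd
    separating⇒injective separating {i} {j} hi≡hj with i ≟ᶠ j
    ... | yes i≡j = i≡j
    ... | no i≢j with realise-any (separating i j i≢j)
    ... | M , _ , inj₁ (i∈ , j∉) = ⊥-elim (j∉ (∈-trace⁺ (subst (_∈ M) hi≡hj (∈-trace⁻ i∈))))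
    ... | M , _ , inj₂ (j∈ , i∉) = ⊥-elim (i∉ (∈-trace⁺ (subst (_∈ M) (sym hi≡hj) (∈-trace⁻ j∈))))

    module _ (injective : Injective _≡_ _≡_ hd) where
      open Distinct injective

      positive-in-model : ∀ {i a M} → IsStable P M → i ∈ˢ trace M → a ∈ pos (clause i) → a ∈ M
      positive-in-model stable i∈ = All.lookup (proj₂ (stable-support stable (∈-trace⁻ i∈)))

      positive-forced : ∀ {i a} → Occurs i → a ∈ pos (clause i) → ∃ λ j → hd j ≡ a × Forces i j
      positive-forced {i} occurs a∈pos with realise-any occurs
      ... | M , stable , i∈ with heads-index (stable⊆heads stable (positive-in-model stable i∈ a∈pos))
      ... | j , refl =
        j , refl , i≢j , realise-all λ stable′ i∈′ → ∈-trace⁺ (positive-in-model stable′ i∈′ a∈pos)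
        where
        i≢j : i ≢ j
        i≢j refl = stable-not-self-positive stable a∈pos (∈-trace⁻ i∈)

      negative-apart : ∀ {i j} → hd j ∈ neg (clause i) → ¬ Together i j
      negative-apart hd∈neg together with realise-any together
      ... | M , stable , i∈ , j∈ =
        proj₁ (stable-support stable (∈-trace⁻ i∈)) (lose hd∈neg (∈-trace⁻ j∈))

      applicable : ∀ {i M} → IsStable P M → (∀ j → j ∈ˢ trace M → Together i j) →
                   Applicable M (clause i)
      applicable stable together blocked with find blocked
      ... | a , a∈neg , a∈M with heads-index (stable⊆heads stable a∈M)
      ... | j , refl = negative-apart a∈neg (together j (∈-trace⁺ a∈M))

      ¬contradictory : ¬ Contradictory
      ¬contradictory (i , occurs , fires) with realise-any fires
      ... | M , stable , i∉ , fire =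
        i∉ (∈-trace⁺ (stable-fires stable (applicable stable (proj₂ ∘ fire)) body))
        where
        body : All (_∈ M) (pos (clause i))
        body = All.tabulate λ a∈pos → let j , hd≡a , forces = positive-forced occurs a∈pos in
                 subst (_∈ M) hd≡a (∈-trace⁻ (proj₁ (fire j) forces))

      module _ (normal : Normal) where

        normal-positive : ∀ i a → a ∉ pos (clause i)
        normal-positive i a a∈pos =
          let occurs , unforced , _ = normal i ; j , _ , forces = positive-forced occurs a∈pos
          in unforced j forces

        normal-negative : ∀ i j → hd j ∈ neg (clause i) ⇔ (¬ Together i j)
        normal-negative i j = mk⇔ negative-apart blocker
          where
          blocker : ¬ Together i j → hd j ∈ neg (clause i)
          blocker apart with proj₂ (proj₂ (normal i)) j
          ... | inj₁ together = contradiction together apart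
          ... | inj₂ sole with realise-any sole
          ... | M , stable , i∉ , only with any? (_∈? M) (neg (clause i))
          ... | no app =
            ⊥-elim (i∉ (∈-trace⁺ (stable-fires stable app (All.tabulate (⊥-elim ∘ normal-positive i _)))))
          ... | yes blocked with find blocked
          ... | a , a∈neg , a∈M with heads-index (stable⊆heads stable a∈M)
          ... | l , refl with only l (∈-trace⁺ a∈M)
          ... | inj₁ together = contradiction together (negative-apart a∈neg)
          ... | inj₂ refl = a∈neg

    certified⇒blocks : Certified →
                       Injective _≡_ _≡_ hd × ∃ λ bs → bs ∈ partitions (length P) × bar P ≈P Blocks bs
    certified⇒blocks (separating , inj₁ contradictory) =
      ⊥-elim (¬contradictory (separating⇒injective separating) contradictory)
    certified⇒blocks (separating , inj₂ (normal , matching)) with find matching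
    ... | bs , bs∈ , matches =
      injective , bs , bs∈ ,
      Distinct.bar≈blocks injective (All.lookup (partitions-are-partitions _) bs∈)
        (normal-positive injective normal) λ i j → ⇔-trans (normal-negative injective normal i j) (matches i j)
      where injective = separating⇒injective separating

block-structure : ∀ P {k} → 2 ≤ length P → length P ≤ 4 → length P ≤ k → HasStableCount P k →
                  Injective _≡_ _≡_ (Traces.hd P)
                  × ∃ λ bs → bs ∈ partitions (length P) × bar P ≈P Traces.Blocks P bs
block-structure P 2≤n n≤4 n≤k (Ms , length-Ms , stable , distinct , _) =
  Realisation.certified⇒blocks realised
    (antichains-certified (length P) 2≤n n≤4 (map trace models) length-traces incomparable)
  where
  open Traces P
  models = take (length P) Ms
  stable-models : All (IsStable P) models
  stable-models = All.take⁺ (length P) stable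
  realised : All Realised (map trace models)
  realised = All.map⁺ (All.map (λ {M} stable → M , stable , refl) stable-models)
  length-traces : length (map trace models) ≡ length P
  length-traces = trans (length-map trace models)
    (trans (length-take (length P) Ms) (m≤n⇒m⊓n≡m (subst (length P ≤_) (sym length-Ms) n≤k)))
  incomparable : AllPairs Incomparable (map trace models)
  incomparable = stable-traces-incomparable stable-models (AllPairs.take⁺ (length P) distinct)

fresh : (xs : List Atom) → ∃ λ y → All (_≢ y) xs
fresh xs = suc (max 0 xs) , All.map (λ x≤max → <⇒≢ (s≤s x≤max)) (xs≤max 0 xs)

CPShaped : ℕ → Program → Set
CPShaped n Q = ∃ λ (a : Atom) → ∃ λ (b : Atom) → ∃ λ (c : Atom) → ∃ λ (d : Atom)
  → ¬ (a ≡ b) × ¬ (a ≡ c) × ¬ (a ≡ d) × ¬ (b ≡ c) × ¬ (b ≡ d) × ¬ (c ≡ d)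
  × (n ≡ 2 → Q ≈P CP (a ∷ b ∷ []))
  × (n ≡ 3 → Q ≈P CP (a ∷ b ∷ c ∷ []))
  × (n ≡ 4 → (Q ≈P CP (a ∷ b ∷ c ∷ d ∷ [])) ⊎ (Q ≈P (CP (a ∷ b ∷ []) ++ CP (c ∷ d ∷ []))))

cp-shaped₄ : ∀ {Q a b c d} → a ≢ b → a ≢ c → a ≢ d → b ≢ c → b ≢ d → c ≢ d →
             (Q ≈P CP (a ∷ b ∷ c ∷ d ∷ [])) ⊎ (Q ≈P (CP (a ∷ b ∷ []) ++ CP (c ∷ d ∷ []))) →
             CPShaped 4 Q
cp-shaped₄ a≢b a≢c a≢d b≢c b≢d c≢d shape =
  _ , _ , _ , _ , a≢b , a≢c , a≢d , b≢c , b≢d , c≢d , (λ ()) , (λ ()) , λ _ → shape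

module _ {n} {h : Fin n → Atom} (injective : Injective _≡_ _≡_ h) where

  apart : ∀ {i j} → i ≢ j → h i ≢ h j
  apart i≢j = i≢j ∘ injective

  pairing-shape : ∀ {Q p q r s} → p ≢ q → p ≢ r → p ≢ s → q ≢ r → q ≢ s → r ≢ s →
                  Q ≈P concatMap (CP ∘ map h) ((p ∷ q ∷ []) ∷ (r ∷ s ∷ []) ∷ []) → CPShaped 4 Q
  pairing-shape {Q} {p} {q} {r} {s} p≢q p≢r p≢s q≢r q≢s r≢s Q≈ =
    cp-shaped₄ (apart p≢q) (apart p≢r) (apart p≢s) (apart q≢r) (apart q≢s) (apart r≢s)
      (inj₂ (subst (λ R → Q ≈P (CP (h p ∷ h q ∷ []) ++ R)) (++-identityʳ (CP (h r ∷ h s ∷ []))) Q≈))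

partition-shape : ∀ {n} {h : Fin n → Atom} → Injective _≡_ _≡_ h → ∀ {bs} → bs ∈ partitions n →
                  ∀ {Q} → Q ≈P concatMap (CP ∘ map h) bs → CPShaped n Q
partition-shape {2} {h} injective (here refl) {Q} Q≈ with fresh (h (# 0) ∷ h (# 1) ∷ [])
... | c , a≢c ∷ b≢c ∷ [] with fresh (h (# 0) ∷ h (# 1) ∷ c ∷ [])
... | d , a≢d ∷ b≢d ∷ c≢d ∷ [] =
  h (# 0) , h (# 1) , c , d , apart injective (λ ()) , a≢c , a≢d , b≢c , b≢d , c≢d ,
  (λ _ → subst (Q ≈P_) (++-identityʳ _) Q≈) , (λ ()) , (λ ())
partition-shape {3} {h} injective (here refl) {Q} Q≈ with fresh (h (# 0) ∷ h (# 1) ∷ h (# 2) ∷ [])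
... | d , a≢d ∷ b≢d ∷ c≢d ∷ [] =
  h (# 0) , h (# 1) , h (# 2) , d , apart injective (λ ()) , apart injective (λ ()) , a≢d ,
  apart injective (λ ()) , b≢d , c≢d , (λ ()) , (λ _ → subst (Q ≈P_) (++-identityʳ _) Q≈) , (λ ())
partition-shape {4} injective (here refl) {Q} Q≈ =
  cp-shaped₄ (apart injective (λ ())) (apart injective (λ ())) (apart injective (λ ()))
             (apart injective (λ ())) (apart injective (λ ())) (apart injective (λ ()))
             (inj₁ (subst (Q ≈P_) (++-identityʳ _) Q≈))
partition-shape {4} injective (there (here refl)) =
  pairing-shape injective (λ ()) (λ ()) (λ ()) (λ ()) (λ ()) (λ ())
partition-shape {4} injective (there (there (here refl))) =
  pairing-shape injective (λ ()) (λ ()) (λ ()) (λ ()) (λ ()) (λ ())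
partition-shape {4} injective (there (there (there (here refl)))) =
  pairing-shape injective (λ ()) (λ ()) (λ ()) (λ ()) (λ ()) (λ ())

lemma14 : ∀ (n : ℕ) (P : Program) (k : ℕ)
            → 2 ≤ n → n ≤ 4
            → HasExactlyClauses n P
            → IsS n k
            → HasStableCount P k
            → ∃ λ (a : Atom) → ∃ λ (b : Atom) → ∃ λ (c : Atom) → ∃ λ (d : Atom)
                → ¬ (a ≡ b) × ¬ (a ≡ c) × ¬ (a ≡ d) × ¬ (b ≡ c) × ¬ (b ≡ d) × ¬ (c ≡ d)
                × (n ≡ 2 → bar P ≈P CP (a ∷ b ∷ []))
                × (n ≡ 3 → bar P ≈P CP (a ∷ b ∷ c ∷ []))
                × (n ≡ 4 → (bar P ≈P CP (a ∷ b ∷ c ∷ d ∷ []))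
                           ⊎ (bar P ≈P (CP (a ∷ b ∷ []) ++ CP (c ∷ d ∷ []))))
lemma14 _ P _ 2≤n n≤4 (refl , _) isS count =
  let injective , _ , bs∈partitions , bar≈blocks = block-structure P 2≤n n≤4 (IsS⇒n≤k isS) count
  in partition-shape injective bs∈partitions bar≈blocks
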